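{- Let $X$ be a finite connected directed graph and let $X=X_0\leftarrow X_1\leftarrow X_2\leftarrow\cdots$ be a $\mathbb{Z}_p$-tower over $X$. Then $X_n$ is connected for every $n\ge 0$.
   Context: Directed graphs may have multiple edges and loops; a directed graph is called connected if the undirected graph obtained by forgetting the orientations of its edges is connected. For a covering of directed graphs $\pi:Y\to X$, a deck transformation is a graph automorphism $\sigma$ of $Y$ with $\pi\circ\sigma=\pi$. The covering is $d$-sheeted if every vertex of $X$ has exactly $d$ preimages in $Y$, and it is Galois if it is $d$-sheeted for some $d$ and its group of deck transformations has exactly $d$ elements. A $\mathbb{Z}_p$-tower over $X$ ($p$ a prime) is a sequence of graph coverings $X=X_0\leftarrow X_1\leftarrow X_2\leftarrow\cdots$ such that for each $n\ge0$ the covering $X_n\to X$ is Galois with group of deck transformations isomorphic to $\mathbb{Z}/p^n\mathbb{Z}$. -}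

module Defs where

open import Data.Nat using (ℕ; zero; suc; _+_; _^_)
open import Data.Nat.DivMod using (_mod_)
open import Data.Nat.Primality using (Prime)
open import Data.Fin using (Fin; toℕ)
open import Data.Product using (Σ; ∃; _×_; _,_)
open import Relation.Binary.PropositionalEquality using (_≡_; refl; trans; cong)
open import Relation.Binary.Construct.Closure.Equivalence using (EqClosure)
open import Function.Definitions using (Bijective)

record Graph : Set where
  field
    nV nE : ℕ
    src tgt : Fin nE → Fin nV

open Graph public

V E : Graph → Set
V G = Fin (nV G)
E G = Fin (nE G)

record Morphism (Y X : Graph) : Set where
  field
    vmap : V Y → V X
    emap : E Y → E X
    src-comm : ∀ e → vmap (src Y e) ≡ src X (emap e)
    tgt-comm : ∀ e → vmap (tgt Y e) ≡ tgt X (emap e)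

open Morphism public

idM : ∀ {X} → Morphism X X
idM = record { vmap = λ v → v ; emap = λ e → e ; src-comm = λ _ → refl ; tgt-comm = λ _ → refl }

_∘M_ : ∀ {A B C} → Morphism B C → Morphism A B → Morphism A C
g ∘M f = record
  { vmap = λ v → vmap g (vmap f v)
  ; emap = λ e → emap g (emap f e)
  ; src-comm = λ e → trans (cong (vmap g) (src-comm f e)) (src-comm g (emap f e))
  ; tgt-comm = λ e → trans (cong (vmap g) (tgt-comm f e)) (tgt-comm g (emap f e))
  }

record IsCovering {Y X : Graph} (π : Morphism Y X) : Set where
  field
    surj : ∀ (x : V X) → ∃ λ (y : V Y) → vmap π y ≡ x
    out-bij : ∀ (y : V Y) (e' : E X) → src X e' ≡ vmap π y →
      Σ (E Y) λ e → (src Y e ≡ y × emap π e ≡ e') ×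
        (∀ e₁ → src Y e₁ ≡ y → emap π e₁ ≡ e' → e₁ ≡ e)
    in-bij : ∀ (y : V Y) (e' : E X) → tgt X e' ≡ vmap π y →
      Σ (E Y) λ e → (tgt Y e ≡ y × emap π e ≡ e') ×
        (∀ e₁ → tgt Y e₁ ≡ y → emap π e₁ ≡ e' → e₁ ≡ e)

Adj : (G : Graph) → V G → V G → Set
Adj G u v = ∃ λ (e : E G) → src G e ≡ u × tgt G e ≡ v

Connected : Graph → Set
Connected G = V G × (∀ (u v : V G) → EqClosure (Adj G) u v)

record Deck {Y X : Graph} (π : Morphism Y X) : Set where
  field
    σ : Morphism Y Y
    vbij : Bijective _≡_ _≡_ (vmap σ)
    ebij : Bijective _≡_ _≡_ (emap σ)
    over-v : ∀ v → vmap π (vmap σ v) ≡ vmap π v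
    over-e : ∀ e → emap π (emap σ e) ≡ emap π e

open Deck public

_≈D_ : ∀ {Y X} {π : Morphism Y X} → Deck π → Deck π → Set
_≈D_ {Y} s t = (∀ v → vmap (σ s) v ≡ vmap (σ t) v) × (∀ e → emap (σ s) e ≡ emap (σ t) e)

Sheeted : ∀ {Y X} → Morphism Y X → ℕ → Set
Sheeted {Y} {X} π d = ∀ (x : V X) →
  Σ (Fin d → V Y) λ g → (∀ i → vmap π (g i) ≡ x) × (∀ i j → g i ≡ g j → i ≡ j) ×
    (∀ y → vmap π y ≡ x → ∃ λ i → g i ≡ y)

DeckCard : ∀ {Y X} → Morphism Y X → ℕ → Set
DeckCard π d = Σ (Fin d → Deck π) λ f → (∀ i j → f i ≈D f j → i ≡ j) × (∀ s → ∃ λ i → f i ≈D s)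

IsGalois : ∀ {Y X} → Morphism Y X → Set
IsGalois π = ∃ λ d → Sheeted π d × DeckCard π d

_+ₘ_ : ∀ {m} → Fin m → Fin m → Fin m
_+ₘ_ {suc k} a b = (toℕ a + toℕ b) mod (suc k)

DeckGroup≅ℤmod : ∀ {Y X} → Morphism Y X → ℕ → Set
DeckGroup≅ℤmod π m = Σ (Fin m → Deck π) λ f →
  (∀ i j → f i ≈D f j → i ≡ j) × (∀ s → ∃ λ i → f i ≈D s) ×
  (∀ a b → ((∀ v → vmap (σ (f (a +ₘ b))) v ≡ vmap (σ (f a)) (vmap (σ (f b)) v))
          × (∀ e → emap (σ (f (a +ₘ b))) e ≡ emap (σ (f a)) (emap (σ (f b)) e))))

down : (Xs : ℕ → Graph) → (∀ n → Morphism (Xs (suc n)) (Xs n)) → ∀ n → Morphism (Xs n) (Xs 0)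
down Xs c zero = idM
down Xs c (suc n) = down Xs c n ∘M c n

record IsZpTower (p : ℕ) (Xs : ℕ → Graph) (c : ∀ n → Morphism (Xs (suc n)) (Xs n)) : Set where
  field
    covering : ∀ n → IsCovering (c n)
    galois : ∀ n → IsGalois (down Xs c n)
    deckgroup : ∀ n → DeckGroup≅ℤmod (down Xs c n) (p ^ n)

-- Let m = p^(N+1) > 2 be the order of the cyclic deck group of a level Y → X of the tower.
-- The element p^N lies in every nontrivial subgroup of ℤ/m and moves some vertex y₀, so the
-- stabiliser of y₀ is trivial, and since the cover is Galois the orbit of y₀ is its whole fibre.
-- If y₀ is joined to 1·y₀, the whole orbit, hence by path lifting all of Y, is one component.
-- Otherwise acting by 1 on the component of y₀, by -1 on that of 1·y₀ and trivially elsewhere is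
-- an involutive deck transformation agreeing with 1 at y₀; by freeness it is the translation by 1,
-- so 2·y₀ = y₀ and m ∣ 2. Every level X_n is the image of X_{n+2}, for which m > 2.
module Submission where

open import Defs
open import Data.Bool using (if_then_else_)
open import Data.Empty using (⊥; ⊥-elim)
open import Data.Fin using (Fin; toℕ; punchOut)
open import Data.Fin.Properties
  using (_≟_; toℕ-injective; toℕ-fromℕ<; toℕ<n; any?; all?; ¬∀⟶∃¬; injective⇒≤; punchOut-injective)
open import Data.Fin.Subset using (Subset; _∈_; _⊆_; _⊃_; ⁅_⁆)
open import Data.Fin.Subset.Induction using (⊃-wellFounded)
open import Data.Fin.Subset.Properties using (_∈?_; x∈⁅x⁆; x∈⁅y⁆⇒x≡y)
open import Data.Nat
  using (ℕ; zero; suc; 2+; _+_; _*_; _∸_; _^_; _≤_; _<_; z≤n; s≤s; NonZero; >-nonZero⁻¹; ≢-nonZero⁻¹; nonTrivial⇒n>1)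
open import Data.Nat.Coprimality using (Coprime; coprime-divisor)
open import Data.Nat.Divisibility using (_∣_; _∣?_; divides; ∣⇒≤; ∣1⇒≡1; *-cancelˡ-∣; *-monoˡ-∣)
open import Data.Nat.DivMod using (_%_; _mod_; m%n<n; %-distribˡ-+; [m+kn]%n≡m%n; m<n⇒m%n≡m)
open import Data.Nat.GCD using (gcd; gcd-GCD; gcd[m,n]∣m; gcd[m,n]∣n; module Bézout)
open import Data.Nat.Primality using (Prime; prime⇒irreducible; prime⇒nonZero; prime⇒nonTrivial)
open import Data.Nat.Properties
  using (≤-total; <⇒≤; <⇒≱; <-trans; <-≤-trans; ≤-<-trans; n<1+n; +-identityʳ; m+[n∸m]≡n; m∸n+n≡m; m∸n≤m;
         *-comm; *-identityˡ; *-identityʳ; m^n≢0; ^-monoʳ-<)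
open import Data.Product using (Σ; ∃; _×_; _,_; proj₁; proj₂)
open import Data.Sum using (_⊎_; inj₁; inj₂)
open import Data.Vec using (tabulate)
open import Data.Vec.Properties using (lookup∘tabulate; lookup⇒[]=; []=⇒lookup)
open import Function.Consequences.Propositional
  using (inverseᵇ⇒bijective; strictlyInverseˡ⇒inverseˡ; strictlyInverseʳ⇒inverseʳ)
open import Function.Definitions using (Bijective; Injective)
open import Induction.WellFounded using (Acc; acc)
open import Relation.Binary.Construct.Closure.Equivalence using (EqClosure; gmap; symmetric)
open import Relation.Binary.Construct.Closure.ReflexiveTransitive using (ε; _◅_; _◅◅_)
open import Relation.Binary.Construct.Closure.Symmetric using (fwd; bwd)
open import Relation.Binary.PropositionalEquality
open import Relation.Nullary using (¬_; Dec; yes; no; contradiction)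
open import Relation.Nullary.Decidable using (does; dec-true; decidable-stable; ¬?; _×-dec_; _⊎-dec_)
open import Relation.Unary using (Decidable)

private
  variable
    X Y Z : Graph

∣p^[1+n]⇒∣p^n⊎≡p^[1+n] : ∀ {p d} → Prime p → ∀ n → d ∣ p ^ suc n → d ∣ p ^ n ⊎ d ≡ p ^ suc n
∣p^[1+n]⇒∣p^n⊎≡p^[1+n] {p} {d} pr n d∣p^[1+n] with p ∣? d
... | no p∤d = inj₁ (coprime-divisor d⊥p d∣p^[1+n])
  where
  d⊥p : Coprime d p
  d⊥p (i∣d , i∣p) with prime⇒irreducible pr i∣p
  ... | inj₁ i≡1 = i≡1
  ... | inj₂ refl = contradiction i∣d p∤d
... | yes (divides q refl) = lift n (*-cancelˡ-∣ p {{prime⇒nonZero pr}} (subst (_∣ p * p ^ n) (*-comm q p) d∣p^[1+n]))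
  where
  lift : ∀ n → q ∣ p ^ n → q * p ∣ p ^ n ⊎ q * p ≡ p ^ suc n
  lift zero q∣1 rewrite ∣1⇒≡1 q∣1 = inj₂ (*-comm 1 p)
  lift (suc n) q∣p^[1+n] with ∣p^[1+n]⇒∣p^n⊎≡p^[1+n] pr n q∣p^[1+n]
  ... | inj₁ q∣p^n = inj₁ (subst (q * p ∣_) (*-comm (p ^ n) p) (*-monoˡ-∣ p q∣p^n))
  ... | inj₂ refl = inj₂ (*-comm (p ^ suc n) p)

∣∧<⇒≡0 : ∀ {m a} → m ∣ a → a < m → a ≡ 0
∣∧<⇒≡0 {a = zero} _ _ = refl
∣∧<⇒≡0 {a = suc a} m∣a a<m = contradiction (∣⇒≤ m∣a) (<⇒≱ a<m)

2<p^[2+n] : ∀ {p} → Prime p → ∀ n → 2 < p ^ 2+ n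
2<p^[2+n] {p} pr n = ≤-<-trans 2≤p^1 (^-monoʳ-< p 1<p {1} {2+ n} (s≤s (s≤s z≤n)))
  where
  1<p : 1 < p
  1<p = nonTrivial⇒n>1 p {{prime⇒nonTrivial pr}}
  2≤p^1 : 2 ≤ p ^ 1
  2≤p^1 = subst (2 ≤_) (sym (*-identityʳ p)) 1<p

toℕ-+ₘ : ∀ {m} .{{_ : NonZero m}} (i j : Fin m) → toℕ (i +ₘ j) ≡ (toℕ i + toℕ j) % m
toℕ-+ₘ {suc _} i j = toℕ-fromℕ< _

module _ {m : ℕ} .{{_ : NonZero m}} where

  toℕ-mod : ∀ a → toℕ (a mod m) ≡ a % m
  toℕ-mod a = toℕ-fromℕ< (m%n<n a m)

  mod-cong : ∀ {a b} → a % m ≡ b % m → a mod m ≡ b mod m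
  mod-cong {a} {b} eq = toℕ-injective (trans (toℕ-mod a) (trans eq (sym (toℕ-mod b))))

  mod-injective : ∀ {a b} → a < m → b < m → a mod m ≡ b mod m → a ≡ b
  mod-injective {a} {b} a<m b<m eq = begin
    a               ≡⟨ m<n⇒m%n≡m a<m ⟨
    a % m           ≡⟨ toℕ-mod a ⟨
    toℕ (a mod m)   ≡⟨ cong toℕ eq ⟩
    toℕ (b mod m)   ≡⟨ toℕ-mod b ⟩
    b % m           ≡⟨ m<n⇒m%n≡m b<m ⟩
    b               ∎
    where open ≡-Reasoning

  mod-+ : ∀ a b → (a + b) mod m ≡ (a mod m) +ₘ (b mod m)
  mod-+ a b = toℕ-injective (begin
    toℕ ((a + b) mod m)                  ≡⟨ toℕ-mod (a + b) ⟩
    (a + b) % m                          ≡⟨ %-distribˡ-+ a b m ⟩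
    (a % m + b % m) % m                  ≡⟨ cong₂ (λ x y → (x + y) % m) (toℕ-mod a) (toℕ-mod b) ⟨
    (toℕ (a mod m) + toℕ (b mod m)) % m  ≡⟨ toℕ-+ₘ (a mod m) (b mod m) ⟨
    toℕ ((a mod m) +ₘ (b mod m))         ∎)
    where open ≡-Reasoning

injective⇒surjective : ∀ {m n} (f : Fin m → Fin n) → Injective _≡_ _≡_ f → n ≤ m → ∀ j → ∃ λ i → f i ≡ j
injective⇒surjective {m} {suc n} f f-injective n≤m j with any? (λ i → f i ≟ j)
... | yes hit = hit
... | no miss = contradiction (injective⇒≤ g-injective) (<⇒≱ (<-≤-trans (n<1+n n) n≤m))
  where
  g : Fin m → Fin n
  g i = punchOut (λ j≡fi → miss (i , sym j≡fi))
  g-injective : Injective _≡_ _≡_ g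
  g-injective {a} {b} eq =
    f-injective (punchOut-injective {i = j} (λ j≡fa → miss (a , sym j≡fa)) (λ j≡fb → miss (b , sym j≡fb)) eq)

involutive⇒bijective : {A : Set} (f : A → A) → (∀ x → f (f x) ≡ x) → Bijective _≡_ _≡_ f
involutive⇒bijective f inv = inverseᵇ⇒bijective (strictlyInverseˡ⇒inverseˡ f inv , strictlyInverseʳ⇒inverseʳ f inv)

module _ {n : ℕ} where

  fromDec : {P : Fin n → Set} → Decidable P → Subset n
  fromDec P? = tabulate (λ x → does (P? x))

  ∈-fromDec⁺ : {P : Fin n → Set} (P? : Decidable P) {x : Fin n} → P x → x ∈ fromDec P?
  ∈-fromDec⁺ P? {x} px = lookup⇒[]= x _ (trans (lookup∘tabulate _ x) (dec-true (P? x) px))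

  ∈-fromDec⁻ : {P : Fin n → Set} (P? : Decidable P) {x : Fin n} → x ∈ fromDec P? → P x
  ∈-fromDec⁻ P? {x} x∈ with P? x | trans (sym (lookup∘tabulate (λ y → does (P? y)) x)) ([]=⇒lookup x∈)
  ... | yes px | _ = px
  ... | no _ | ()

  -- Iterate F until it stops growing: Subset n has no infinite strictly increasing chain.
  postfixpoint : (F : Subset n → Subset n) → (∀ p → p ⊆ F p) →
    (I : Subset n → Set) → (∀ {p} → I p → I (F p)) → ∀ {p} → I p → ∃ λ q → I q × F q ⊆ q
  postfixpoint F inflationary I I-F {p} = iterate (⊃-wellFounded p)
    where
    iterate : ∀ {p} → Acc _⊃_ p → I p → ∃ λ q → I q × F q ⊆ q
    iterate {p} (acc larger) Ip with any? (λ x → x ∈? F p ×-dec ¬? (x ∈? p))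
    ... | yes (x , x∈Fp , x∉p) = iterate (larger (inflationary p , x , x∈Fp , x∉p)) (I-F Ip)
    ... | no none = p , Ip , λ {x} x∈Fp → decidable-stable (x ∈? p) (λ x∉p → none (x , x∈Fp , x∉p))

Walk : (G : Graph) → V G → V G → Set
Walk G = EqClosure (Adj G)

map-adj : (φ : Morphism Y X) {u v : V Y} → Adj Y u v → Adj X (vmap φ u) (vmap φ v)
map-adj φ (e , refl , refl) = emap φ e , sym (src-comm φ e) , sym (tgt-comm φ e)

map-walk : (φ : Morphism Y X) {u v : V Y} → Walk Y u v → Walk X (vmap φ u) (vmap φ v)
map-walk φ = gmap (vmap φ) (map-adj φ)

Connected-image : (φ : Morphism Y X) → (∀ x → ∃ λ y → vmap φ y ≡ x) → Connected Y → Connected X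
Connected-image {Y} {X} φ surj (y , walk) = vmap φ y , joined
  where
  joined : ∀ u v → Walk X u v
  joined u v with surj u | surj v
  ... | a , refl | b , refl = map-walk φ (walk a b)

module _ (G : Graph) where

  adj? : ∀ u v → Dec (Adj G u v)
  adj? u v = any? λ e → (src G e ≟ u) ×-dec (tgt G e ≟ v)

  Step : V G → V G → Set
  Step u v = u ≡ v ⊎ Adj G u v ⊎ Adj G v u

  step-walk : ∀ {u v} → Step u v → Walk G u v
  step-walk (inj₁ refl) = ε
  step-walk (inj₂ (inj₁ a)) = fwd a ◅ ε
  step-walk (inj₂ (inj₂ a)) = bwd a ◅ ε

  Near : Subset (nV G) → V G → Set
  Near S v = ∃ λ u → u ∈ S × Step u v

  near? : ∀ S → Decidable (Near S)
  near? S v = any? λ u → u ∈? S ×-dec ((u ≟ v) ⊎-dec (adj? u v ⊎-dec adj? v u))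

  expand : Subset (nV G) → Subset (nV G)
  expand S = fromDec (near? S)

  expand-inflationary : ∀ S → S ⊆ expand S
  expand-inflationary S {u} u∈S = ∈-fromDec⁺ (near? S) (u , u∈S , inj₁ refl)

  Reached : V G → Subset (nV G) → Set
  Reached s S = s ∈ S × (∀ {u} → u ∈ S → Walk G s u)

  reached-⁅⁆ : ∀ s → Reached s ⁅ s ⁆
  reached-⁅⁆ s = x∈⁅x⁆ s , λ {u} u∈⁅s⁆ → subst (Walk G s) (sym (x∈⁅y⁆⇒x≡y s u∈⁅s⁆)) ε

  reached-expand : ∀ {s S} → Reached s S → Reached s (expand S)
  reached-expand {S = S} (s∈S , walks) = expand-inflationary S s∈S , λ u∈ →
    let _ , u∈S , step = ∈-fromDec⁻ (near? S) u∈ in walks u∈S ◅◅ step-walk step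

  expand-closed⇒walk-closed : ∀ {S} → expand S ⊆ S → ∀ {u w} → Walk G u w → u ∈ S → w ∈ S
  expand-closed⇒walk-closed closed ε u∈S = u∈S
  expand-closed⇒walk-closed {S} closed (fwd a ◅ walk) u∈S =
    expand-closed⇒walk-closed closed walk (closed (∈-fromDec⁺ (near? S) (_ , u∈S , inj₂ (inj₁ a))))
  expand-closed⇒walk-closed {S} closed (bwd a ◅ walk) u∈S =
    expand-closed⇒walk-closed closed walk (closed (∈-fromDec⁺ (near? S) (_ , u∈S , inj₂ (inj₂ a))))

  walk? : ∀ s v → Dec (Walk G s v)
  walk? s v with postfixpoint expand expand-inflationary (Reached s) reached-expand (reached-⁅⁆ s)
  ... | S , (s∈S , walks) , closed with v ∈? S
  ... | yes v∈S = yes (walks v∈S)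
  ... | no v∉S = no λ walk → v∉S (expand-closed⇒walk-closed closed walk s∈S)

-- Coverings and deck transformations

-- Both unique-lifting conditions of a covering, abstracted over the end (source or target) of an edge.
module _ (end : (G : Graph) → E G → V G) where

  UniqueLifting : Morphism Y X → Set
  UniqueLifting {Y} {X} π = ∀ (y : V Y) (e' : E X) → end X e' ≡ vmap π y →
    Σ (E Y) λ e → (end Y e ≡ y × emap π e ≡ e') × (∀ e₁ → end Y e₁ ≡ y → emap π e₁ ≡ e' → e₁ ≡ e)

  ∘-uniqueLifting : (g : Morphism Y X) (f : Morphism Z Y) →
    (∀ e → vmap f (end Z e) ≡ end Y (emap f e)) →
    UniqueLifting g → UniqueLifting f → UniqueLifting (g ∘M f)
  ∘-uniqueLifting g f end-comm liftG liftF z e' eq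
    with eY , (endY , gY) , uniqueY ← liftG (vmap f z) e' eq
    with eZ , (endZ , fZ) , uniqueZ ← liftF z eY endY =
    eZ , (endZ , trans (cong (emap g) fZ) gY) ,
    λ e₁ end₁ ge₁ → uniqueZ e₁ end₁ (uniqueY (emap f e₁) (trans (sym (end-comm e₁)) (cong (vmap f) end₁)) ge₁)

id-covering : IsCovering (idM {X})
id-covering = record
  { surj = λ x → x , refl
  ; out-bij = λ y e' eq → e' , (eq , refl) , λ _ _ eq₁ → eq₁
  ; in-bij = λ y e' eq → e' , (eq , refl) , λ _ _ eq₁ → eq₁
  }

∘-covering : {g : Morphism Y X} {f : Morphism Z Y} → IsCovering g → IsCovering f → IsCovering (g ∘M f)
∘-covering {g = g} {f} covG covF = record
  { surj = λ x → let y , gy = G.surj x ; z , fz = F.surj y in z , trans (cong (vmap g) fz) gy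
  ; out-bij = ∘-uniqueLifting src g f (src-comm f) G.out-bij F.out-bij
  ; in-bij = ∘-uniqueLifting tgt g f (tgt-comm f) G.in-bij F.in-bij
  }
  where
  module G = IsCovering covG
  module F = IsCovering covF

down-covering : (Xs : ℕ → Graph) (c : ∀ n → Morphism (Xs (suc n)) (Xs n)) →
  (∀ n → IsCovering (c n)) → ∀ n → IsCovering (down Xs c n)
down-covering Xs c cov zero = id-covering
down-covering Xs c cov (suc n) = ∘-covering (down-covering Xs c cov n) (cov n)

module _ {π : Morphism Y X} (cov : IsCovering π) where
  open IsCovering cov

  lift-walk : ∀ {x x'} → Walk X x x' → ∀ y → vmap π y ≡ x → ∃ λ y' → vmap π y' ≡ x' × Walk Y y y'
  lift-walk ε y eq = y , eq , ε
  lift-walk (fwd (e , refl , refl) ◅ walk) y eq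
    with eY , (srcY , refl) , _ ← out-bij y e (sym eq)
    with y' , eq' , walkY ← lift-walk walk (tgt Y eY) (tgt-comm π eY) =
    y' , eq' , fwd (eY , srcY , refl) ◅ walkY
  lift-walk (bwd (e , refl , refl) ◅ walk) y eq
    with eY , (tgtY , refl) , _ ← in-bij y e (sym eq)
    with y' , eq' , walkY ← lift-walk walk (src Y eY) (src-comm π eY) =
    y' , eq' , bwd (eY , refl , tgtY) ◅ walkY

  fixes-vertices⇒fixes-edges : (φ : Morphism Y Y) → (∀ e → emap π (emap φ e) ≡ emap π e) →
    (∀ v → vmap φ v ≡ v) → ∀ e → emap φ e ≡ e
  fixes-vertices⇒fixes-edges φ over fixed e =
    let _ , _ , unique = out-bij (src Y e) (emap π e) (sym (src-comm π e)) in
    trans (unique (emap φ e) (trans (sym (src-comm φ e)) (fixed (src Y e))) (over e)) (sym (unique e refl refl))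

record Over (π : Morphism Y X) (φ : Morphism Y Y) : Set where
  constructor over
  field
    over-vertices : ∀ v → vmap π (vmap φ v) ≡ vmap π v
    over-edges : ∀ e → emap π (emap φ e) ≡ emap π e

id-over : {π : Morphism Y X} → Over π idM
id-over = over (λ _ → refl) (λ _ → refl)

deck-over : {π : Morphism Y X} (s : Deck π) → Over π (σ s)
deck-over s = over (over-v s) (over-e s)

involution⇒Deck : {π : Morphism Y X} → IsCovering π → (φ : Morphism Y Y) → Over π φ →
  (∀ v → vmap φ (vmap φ v) ≡ v) → Deck π
involution⇒Deck {Y} {π = π} cov φ (over overV overE) inv = record
  { σ = φ
  ; vbij = involutive⇒bijective (vmap φ) inv
  ; ebij = involutive⇒bijective (emap φ) (fixes-vertices⇒fixes-edges cov (φ ∘M φ) overE² inv)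
  ; over-v = overV
  ; over-e = overE
  }
  where
  overE² : ∀ e → emap π (emap φ (emap φ e)) ≡ emap π e
  overE² e = trans (overE (emap φ e)) (overE e)

-- As P is a union of connected components, a morphism may be chosen independently on P and off P.
module Glue {P : V Y → Set} (P? : Decidable P) (saturated : ∀ {u v} → Walk Y u v → P u → P v) where

  glue : Morphism Y Z → Morphism Y Z → Morphism Y Z
  glue {Z} f g = record
    { vmap = λ v → if does (P? v) then vmap f v else vmap g v
    ; emap = λ e → if does (P? (src Y e)) then emap f e else emap g e
    ; src-comm = src-comm′
    ; tgt-comm = tgt-comm′
    }
    where
    src-comm′ : ∀ e → (if does (P? (src Y e)) then vmap f (src Y e) else vmap g (src Y e))
                    ≡ src Z (if does (P? (src Y e)) then emap f e else emap g e)
    src-comm′ e with P? (src Y e)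
    ... | yes _ = src-comm f e
    ... | no _ = src-comm g e
    tgt-comm′ : ∀ e → (if does (P? (tgt Y e)) then vmap f (tgt Y e) else vmap g (tgt Y e))
                    ≡ tgt Z (if does (P? (src Y e)) then emap f e else emap g e)
    tgt-comm′ e with P? (tgt Y e) | P? (src Y e)
    ... | yes _ | yes _ = tgt-comm f e
    ... | no _ | no _ = tgt-comm g e
    ... | yes Pt | no ¬Ps = contradiction (saturated (bwd (e , refl , refl) ◅ ε) Pt) ¬Ps
    ... | no ¬Pt | yes Ps = contradiction (saturated (fwd (e , refl , refl) ◅ ε) Ps) ¬Pt

  glue-∈ : (f g : Morphism Y Z) {v : V Y} → P v → vmap (glue f g) v ≡ vmap f v
  glue-∈ f g {v} Pv with P? v
  ... | yes _ = refl
  ... | no ¬Pv = contradiction Pv ¬Pv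

  glue-∉ : (f g : Morphism Y Z) {v : V Y} → ¬ P v → vmap (glue f g) v ≡ vmap g v
  glue-∉ f g {v} ¬Pv with P? v
  ... | yes Pv = contradiction Pv ¬Pv
  ... | no _ = refl

  glue-over : {π : Morphism Y X} {f g : Morphism Y Y} → Over π f → Over π g → Over π (glue f g)
  glue-over {π = π} {f} {g} (over fV fE) (over gV gE) = over overV overE
    where
    overV : ∀ v → vmap π (vmap (glue f g) v) ≡ vmap π v
    overV v with P? v
    ... | yes _ = fV v
    ... | no _ = gV v
    overE : ∀ e → emap π (emap (glue f g) e) ≡ emap π e
    overE e with P? (src Y e)
    ... | yes _ = fE e
    ... | no _ = gE e

-- The cyclic deck group acting on vertices

module CyclicAction {π : Morphism Y X} (cov : IsCovering π) (m : ℕ) .{{_ : NonZero m}} (dg : DeckGroup≅ℤmod π m) where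

  deck : Fin m → Deck π
  deck = proj₁ dg

  deck-injective : ∀ i j → deck i ≈D deck j → i ≡ j
  deck-injective = proj₁ (proj₂ dg)

  deck-surjective : ∀ s → ∃ λ i → deck i ≈D s
  deck-surjective = proj₁ (proj₂ (proj₂ dg))

  deck-+ₘ : ∀ i j v → vmap (σ (deck (i +ₘ j))) v ≡ vmap (σ (deck i)) (vmap (σ (deck j)) v)
  deck-+ₘ i j = proj₁ (proj₂ (proj₂ (proj₂ dg)) i j)

  DeckCard⇒≤ : ∀ {d} → DeckCard π d → d ≤ m
  DeckCard⇒≤ {d} (decks , decks-injective , _) = injective⇒≤ index-injective
    where
    index : Fin d → Fin m
    index i = proj₁ (deck-surjective (decks i))
    index-injective : Injective _≡_ _≡_ index
    index-injective {i} {j} eq =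
      let vi , ei = proj₂ (deck-surjective (decks i)) ; vj , ej = proj₂ (deck-surjective (decks j)) in
      decks-injective i j
        ( (λ v → trans (sym (vi v)) (trans (cong (λ k → vmap (σ (deck k)) v) eq) (vj v)))
        , (λ e → trans (sym (ei e)) (trans (cong (λ k → emap (σ (deck k)) e) eq) (ej e))))

  shift : ℕ → Morphism Y Y
  shift a = σ (deck (a mod m))

  shift-over : ∀ a → Over π (shift a)
  shift-over a = deck-over (deck (a mod m))

  act : ℕ → V Y → V Y
  act a = vmap (shift a)

  act-+ : ∀ a b v → act (a + b) v ≡ act a (act b v)
  act-+ a b v = trans (cong (λ i → vmap (σ (deck i)) v) (mod-+ a b)) (deck-+ₘ (a mod m) (b mod m) v)

  act-injective : ∀ a {u v} → act a u ≡ act a v → u ≡ v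
  act-injective a = proj₁ (vbij (deck (a mod m)))

  act-0 : ∀ v → act 0 v ≡ v
  act-0 v = act-injective 0 (sym (act-+ 0 0 v))

  act-*m : ∀ q v → act (q * m) v ≡ v
  act-*m q v = trans (cong (λ i → vmap (σ (deck i)) v) (mod-cong ([m+kn]%n≡m%n 0 q m))) (act-0 v)

  act-m : ∀ v → act m v ≡ v
  act-m v = trans (cong (λ a → act a v) (sym (*-identityˡ m))) (act-*m 1 v)

  act-toℕ : ∀ i v → act (toℕ i) v ≡ vmap (σ (deck i)) v
  act-toℕ i v = cong (λ j → vmap (σ (deck j)) v) (toℕ-injective (trans (toℕ-mod (toℕ i)) (m<n⇒m%n≡m (toℕ<n i))))

  Fixes : V Y → ℕ → Set
  Fixes y a = act a y ≡ y

  shift-fixes-edges : ∀ a → (∀ v → Fixes v a) → ∀ e → emap (shift a) e ≡ e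
  shift-fixes-edges a = fixes-vertices⇒fixes-edges cov (shift a) (over-e (deck (a mod m)))

  fixes-all⇒≡0 : ∀ {a} → a < m → (∀ v → Fixes v a) → a ≡ 0
  fixes-all⇒≡0 {a} a<m fa = mod-injective a<m (>-nonZero⁻¹ m) (deck-injective (a mod m) (0 mod m)
    ( (λ v → trans (fa v) (sym (act-0 v)))
    , (λ e → trans (shift-fixes-edges a fa e) (sym (shift-fixes-edges 0 act-0 e)))))

  fixes-* : ∀ {y a} q → Fixes y a → Fixes y (q * a)
  fixes-* zero _ = act-0 _
  fixes-* {y} {a} (suc q) fa = begin
    act (a + q * a) y     ≡⟨ act-+ a (q * a) y ⟩
    act a (act (q * a) y) ≡⟨ cong (act a) (fixes-* q fa) ⟩
    act a y               ≡⟨ fa ⟩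
    y                     ∎
    where open ≡-Reasoning

  fixes-cancel : ∀ {y} a {b} → Fixes y b → Fixes y (a + b) → Fixes y a
  fixes-cancel {y} a {b} fb fab = begin
    act a y          ≡⟨ cong (act a) fb ⟨
    act a (act b y)  ≡⟨ act-+ a b y ⟨
    act (a + b) y    ≡⟨ fab ⟩
    y                ∎
    where open ≡-Reasoning

  fixes-gcd : ∀ {y a} → Fixes y a → Fixes y (gcd a m)
  fixes-gcd {y} {a} fa with Bézout.identity (gcd-GCD a m)
  ... | Bézout.+- x q eq = fixes-cancel (gcd a m) (act-*m q y) (subst (Fixes y) (sym eq) (fixes-* x fa))
  ... | Bézout.-+ x q eq = fixes-cancel (gcd a m) (fixes-* x fa) (subst (Fixes y) (sym eq) (act-*m q y))

-- Galois covers with deck group ℤ/p^(N+1)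

module PrimePowerCover {π : Morphism Y X} (cov : IsCovering π) (X-connected : Connected X) (galois : IsGalois π)
  {p N : ℕ} (pr : Prime p) (2<m : 2 < p ^ suc N) (dg : DeckGroup≅ℤmod π (p ^ suc N)) where

  m : ℕ
  m = p ^ suc N

  instance
    p≢0 : NonZero p
    p≢0 = prime⇒nonZero pr
    m≢0 : NonZero m
    m≢0 = m^n≢0 p (suc N)

  open CyclicAction cov m dg

  1<m : 1 < m
  1<m = <-trans (n<1+n 1) 2<m

  p^N<m : p ^ N < m
  p^N<m = ^-monoʳ-< p (nonTrivial⇒n>1 p {{prime⇒nonTrivial pr}}) (n<1+n N)

  -- Every nontrivial subgroup of ℤ/p^(N+1) contains the subgroup generated by p^N.
  fixes⇒fixes-p^N : ∀ {y a} → Fixes y a → ¬ m ∣ a → Fixes y (p ^ N)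
  fixes⇒fixes-p^N {y} {a} fa m∤a with ∣p^[1+n]⇒∣p^n⊎≡p^[1+n] pr N (gcd[m,n]∣n a m)
  ... | inj₁ (divides q eq) = subst (Fixes y) (sym eq) (fixes-* q (fixes-gcd fa))
  ... | inj₂ gcd≡m = contradiction (subst (_∣ a) gcd≡m (gcd[m,n]∣m a m)) m∤a

  moved-by-p^N : ∃ λ y → ¬ Fixes y (p ^ N)
  moved-by-p^N with all? (λ v → act (p ^ N) v ≟ v)
  ... | no some-moved = ¬∀⟶∃¬ _ _ (λ v → act (p ^ N) v ≟ v) some-moved
  ... | yes all-fixed = contradiction (fixes-all⇒≡0 p^N<m all-fixed) (≢-nonZero⁻¹ (p ^ N) {{m^n≢0 p N}})

  y₀ : V Y
  y₀ = proj₁ moved-by-p^N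

  free : ∀ {a} → Fixes y₀ a → m ∣ a
  free {a} fa with m ∣? a
  ... | yes m∣a = m∣a
  ... | no m∤a = contradiction (fixes⇒fixes-p^N fa m∤a) (proj₂ moved-by-p^N)

  orbit-injective-≤ : ∀ {a b} → a ≤ b → b < m → act a y₀ ≡ act b y₀ → a ≡ b
  orbit-injective-≤ {a} {b} a≤b b<m eq = begin
    a                ≡⟨ +-identityʳ a ⟨
    a + 0            ≡⟨ cong (a +_) b∸a≡0 ⟨
    a + (b ∸ a)      ≡⟨ m+[n∸m]≡n a≤b ⟩
    b                ∎
    where
    open ≡-Reasoning
    fixes-b∸a : Fixes y₀ (b ∸ a)
    fixes-b∸a = act-injective a (begin
      act a (act (b ∸ a) y₀) ≡⟨ act-+ a (b ∸ a) y₀ ⟨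
      act (a + (b ∸ a)) y₀   ≡⟨ cong (λ c → act c y₀) (m+[n∸m]≡n a≤b) ⟩
      act b y₀               ≡⟨ eq ⟨
      act a y₀               ∎)
    b∸a≡0 : b ∸ a ≡ 0
    b∸a≡0 = ∣∧<⇒≡0 (free fixes-b∸a) (≤-<-trans (m∸n≤m b a) b<m)

  orbit-injective : ∀ {a b} → a < m → b < m → act a y₀ ≡ act b y₀ → a ≡ b
  orbit-injective {a} {b} a<m b<m eq with ≤-total a b
  ... | inj₁ a≤b = orbit-injective-≤ a≤b b<m eq
  ... | inj₂ b≤a = sym (orbit-injective-≤ b≤a a<m (sym eq))

  -- The orbit of y₀ injects into its fibre, which has at most m points since the cover is Galois.
  orbit-covers-fibre : ∀ {y} → vmap π y ≡ vmap π y₀ → ∃ λ a → act a y₀ ≡ y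
  orbit-covers-fibre {y} πy≡πy₀ =
    let j , fibre-j≡y = fibre-surjective y πy≡πy₀
        i , ψi≡j = injective⇒surjective ψ ψ-injective (DeckCard⇒≤ (proj₂ (proj₂ galois))) j
    in toℕ i , trans (sym (fibre-ψ i)) (trans (cong fibre ψi≡j) fibre-j≡y)
    where
    fibre : Fin (proj₁ galois) → V Y
    fibre = proj₁ (proj₁ (proj₂ galois) (vmap π y₀))
    fibre-surjective : ∀ y → vmap π y ≡ vmap π y₀ → ∃ λ j → fibre j ≡ y
    fibre-surjective = proj₂ (proj₂ (proj₂ (proj₁ (proj₂ galois) (vmap π y₀))))
    ψ : Fin m → Fin (proj₁ galois)
    ψ i = proj₁ (fibre-surjective (act (toℕ i) y₀) (over-v (deck _) y₀))
    fibre-ψ : ∀ i → fibre (ψ i) ≡ act (toℕ i) y₀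
    fibre-ψ i = proj₂ (fibre-surjective (act (toℕ i) y₀) (over-v (deck _) y₀))
    ψ-injective : Injective _≡_ _≡_ ψ
    ψ-injective {i} {j} eq = toℕ-injective (orbit-injective (toℕ<n i) (toℕ<n j)
      (trans (sym (fibre-ψ i)) (trans (cong fibre eq) (fibre-ψ j))))

  orbit-walk : Walk Y y₀ (act 1 y₀) → ∀ a → Walk Y y₀ (act a y₀)
  orbit-walk w zero = subst (Walk Y y₀) (sym (act-0 y₀)) ε
  orbit-walk w (suc a) = w ◅◅ subst (Walk Y (act 1 y₀)) (sym (act-+ 1 a y₀)) (map-walk (shift 1) (orbit-walk w a))

  connected-if-joined : Walk Y y₀ (act 1 y₀) → Connected Y
  connected-if-joined w = y₀ , λ u v → symmetric _ (from-y₀ u) ◅◅ from-y₀ v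
    where
    from-y₀ : ∀ u → Walk Y y₀ u
    from-y₀ u with y , πy≡πy₀ , u~y ← lift-walk cov (proj₂ X-connected (vmap π u) (vmap π y₀)) u refl
              with a , refl ← orbit-covers-fibre πy≡πy₀ =
      orbit-walk w a ◅◅ symmetric _ u~y

  module Apart (apart : ¬ Walk Y y₀ (act 1 y₀)) where

    C : V Y → Set
    C = Walk Y y₀

    -- The component of 1·y₀, since m - 1 acts as the inverse of 1.
    C′ : V Y → Set
    C′ v = C (act (m ∸ 1) v)

    module Glue-C = Glue (walk? Y y₀) (λ w c → c ◅◅ w)
    module Glue-C′ = Glue (λ v → walk? Y y₀ (act (m ∸ 1) v)) (λ w c → c ◅◅ map-walk (shift (m ∸ 1)) w)

    back-on-C′ : Morphism Y Y
    back-on-C′ = Glue-C′.glue (shift (m ∸ 1)) idM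

    swap : Morphism Y Y
    swap = Glue-C.glue (shift 1) back-on-C′

    swap-C : ∀ {v} → C v → vmap swap v ≡ act 1 v
    swap-C = Glue-C.glue-∈ (shift 1) back-on-C′

    swap-C′ : ∀ {v} → ¬ C v → C′ v → vmap swap v ≡ act (m ∸ 1) v
    swap-C′ ¬c c′ = trans (Glue-C.glue-∉ (shift 1) back-on-C′ ¬c) (Glue-C′.glue-∈ (shift (m ∸ 1)) idM c′)

    swap-rest : ∀ {v} → ¬ C v → ¬ C′ v → vmap swap v ≡ v
    swap-rest ¬c ¬c′ = trans (Glue-C.glue-∉ (shift 1) back-on-C′ ¬c) (Glue-C′.glue-∉ (shift (m ∸ 1)) idM ¬c′)

    back : ∀ v → act (m ∸ 1) (act 1 v) ≡ v
    back v = trans (sym (act-+ (m ∸ 1) 1 v)) (trans (cong (λ a → act a v) (m∸n+n≡m (<⇒≤ 1<m))) (act-m v))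

    forth : ∀ v → act 1 (act (m ∸ 1) v) ≡ v
    forth v = trans (sym (act-+ 1 (m ∸ 1) v)) (trans (cong (λ a → act a v) (m+[n∸m]≡n (<⇒≤ 1<m))) (act-m v))

    leaves-C : ∀ {v} → C v → ¬ C (act 1 v)
    leaves-C c c₁ = apart (c₁ ◅◅ symmetric _ (map-walk (shift 1) c))

    swap-involutive : ∀ v → vmap swap (vmap swap v) ≡ v
    swap-involutive v = by-cases (walk? Y y₀ v) (walk? Y y₀ (act (m ∸ 1) v))
      where
      by-cases : Dec (C v) → Dec (C′ v) → vmap swap (vmap swap v) ≡ v
      by-cases (yes c) _ = trans (cong (vmap swap) (swap-C c))
                             (trans (swap-C′ (leaves-C c) (subst C (sym (back v)) c)) (back v))
      by-cases (no ¬c) (yes c′) = trans (cong (vmap swap) (swap-C′ ¬c c′)) (trans (swap-C c′) (forth v))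
      by-cases (no ¬c) (no ¬c′) = trans (cong (vmap swap) (swap-rest ¬c ¬c′)) (swap-rest ¬c ¬c′)

    swap-deck : Deck π
    swap-deck = involution⇒Deck cov swap
      (Glue-C.glue-over {f = shift 1} (shift-over 1) (Glue-C′.glue-over {f = shift (m ∸ 1)} (shift-over (m ∸ 1)) id-over))
      swap-involutive

    absurd : ⊥
    absurd = <⇒≱ 2<m (∣⇒≤ (free fixes-2))
      where
      i : Fin m
      i = proj₁ (deck-surjective swap-deck)
      deck-i≡swap : ∀ v → vmap (σ (deck i)) v ≡ vmap swap v
      deck-i≡swap = proj₁ (proj₂ (deck-surjective swap-deck))
      i≡1 : toℕ i ≡ 1
      i≡1 = orbit-injective (toℕ<n i) 1<m (trans (act-toℕ i y₀) (trans (deck-i≡swap y₀) (swap-C ε)))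
      fixes-2 : Fixes y₀ 2
      fixes-2 = begin
        act 2 y₀                     ≡⟨ act-+ 1 1 y₀ ⟩
        act 1 (act 1 y₀)             ≡⟨ cong (λ a → act a (act 1 y₀)) i≡1 ⟨
        act (toℕ i) (act 1 y₀)       ≡⟨ act-toℕ i (act 1 y₀) ⟩
        vmap (σ (deck i)) (act 1 y₀) ≡⟨ deck-i≡swap (act 1 y₀) ⟩
        vmap swap (act 1 y₀)         ≡⟨ swap-C′ apart (subst C (sym (back y₀)) ε) ⟩
        act (m ∸ 1) (act 1 y₀)       ≡⟨ back y₀ ⟩
        y₀                           ∎
        where open ≡-Reasoning

  connected : Connected Y
  connected with walk? Y y₀ (act 1 y₀)
  ... | yes w = connected-if-joined w
  ... | no apart = ⊥-elim (Apart.absurd apart)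

lemma2p8 : (p : ℕ) → Prime p → (Xs : ℕ → Graph) → (c : ∀ n → Morphism (Xs (suc n)) (Xs n)) →
    Connected (Xs 0) → IsZpTower p Xs c → ∀ n → Connected (Xs n)
lemma2p8 p pr Xs c X₀-connected tower n =
  Connected-image (c n ∘M c (suc n)) (IsCovering.surj (∘-covering (covering n) (covering (suc n))))
    (PrimePowerCover.connected (down-covering Xs c covering (2+ n)) X₀-connected (galois (2+ n))
      {N = suc n} pr (2<p^[2+n] pr n) (deckgroup (2+ n)))
  where
  open IsZpTower tower
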